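{- Let $k\ge4$, $n=2k-1$, $\lambda\in\overline{\mathcal{U}}_{T_n}$, let $Y_{S_\lambda}$ be its Keith--Nath Young diagram with hook lengths $h_{i,j}$, and let $z$ be the integer with $h_{1,z+1}=n-2$. Denote by $\#R_i$ and $\#C_i$ the numbers of cells in the $i$-th row and $i$-th column. Then $\#R_i=\#C_i+1$ for $1\le i\le z$, and $\#R_i=\#C_{i+1}$ for $z+1\le i\le n-2$.
   Context: Partitions into distinct parts: $\lambda=(\lambda_1<\dots<\lambda_t)$, $t\ge2$. Missing parts $\mathcal{M}_\lambda=\{1,\dots,\lambda_t\}\setminus\{\lambda_i\}$. Unrefinable: no two distinct missing parts sum to a part. Maximal: largest part is maximum among unrefinable partitions of the same integer. $\overline{\mathcal{U}}_N$: maximal unrefinable partitions of $N$ with $\#\mathcal{M}_\lambda=\lfloor\lambda_t/2\rfloor$. $T_n=n(n+1)/2$. $S_\lambda=\mathbb{N}_0\setminus\lambda$; $Y_{S_\lambda}$ (English convention) has one row per part $g$ of $\lambda$, ordered top to bottom by decreasing $g$, the row of $g$ having $\#\{s\in S_\lambda:s<g\}$ cells. $h_{i,j}$ is the hook length (arm + leg + 1) of the cell in row $i$, column $j$. -}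

module Defs where

open import Data.Nat using (ℕ; zero; suc; _+_; _*_; _∸_; _≤_; _<_; _≤?_; _≟_; _⊔_; _/_)
open import Data.Nat.ListAction using (sum)
open import Data.List using (map; List; []; _∷_; length; filter; reverse; upTo; foldr)
open import Data.List.Membership.Propositional using (_∈_; _∉_)
open import Data.List.Membership.DecPropositional _≟_ using (_∈?_)
open import Data.List.Relation.Unary.All using (All)
open import Data.List.Relation.Unary.Linked using (Linked)
open import Data.Product using (_×_)
open import Relation.Nullary.Negation using (¬_)
open import Relation.Nullary.Decidable using (¬?)
open import Relation.Binary.PropositionalEquality using (_≡_; _≢_)

DistinctPartition : List ℕ → Set
DistinctPartition ps = Linked _<_ ps × All (λ p → 1 ≤ p) ps × 2 ≤ length ps

largest : List ℕ → ℕ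
largest = foldr _⊔_ 0

Missing : List ℕ → ℕ → Set
Missing ps m = 1 ≤ m × m ≤ largest ps × m ∉ ps

numMissing : List ℕ → ℕ
numMissing ps = length (filter (λ m → ¬? (m ∈? ps)) (map suc (upTo (largest ps))))

Unrefinable : List ℕ → Set
Unrefinable ps = ∀ a b → a ≢ b → Missing ps a → Missing ps b → ¬ ((a + b) ∈ ps)

UnrefPartOf : ℕ → List ℕ → Set
UnrefPartOf N ps = DistinctPartition ps × Unrefinable ps × sum ps ≡ N

Maximal : ℕ → List ℕ → Set
Maximal N ps = UnrefPartOf N ps × (∀ μ → UnrefPartOf N μ → largest μ ≤ largest ps)

InUbar : ℕ → List ℕ → Set
InUbar N ps = Maximal N ps × numMissing ps ≡ largest ps / 2

T : ℕ → ℕ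
T n = (n * (n + 1)) / 2

-- #{s ∈ S_λ : s < g}, S_λ = ℕ₀ ∖ ps
gapsBelow : List ℕ → ℕ → ℕ
gapsBelow ps g = length (filter (λ s → ¬? (s ∈? ps)) (upTo g))

-- row lengths of Y_{S_λ}, top to bottom (parts in decreasing order)
rows : List ℕ → List ℕ
rows ps = map (gapsBelow ps) (reverse ps)

-- 1-indexed lookup with default 0
at : List ℕ → ℕ → ℕ
at [] _ = 0
at (x ∷ xs) zero = 0
at (x ∷ xs) (suc zero) = x
at (x ∷ xs) (suc (suc i)) = at xs (suc i)

R : List ℕ → ℕ → ℕ
R ps i = at (rows ps) i

C : List ℕ → ℕ → ℕ
C ps j = length (filter (λ r → j ≤? r) (rows ps))

InDiagram : List ℕ → ℕ → ℕ → Set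
InDiagram ps i j = 1 ≤ i × 1 ≤ j × j ≤ R ps i

hook : List ℕ → ℕ → ℕ → ℕ
hook ps i j = (R ps i ∸ j) + (C ps j ∸ i) + 1

module Submission where

open import Defs
open import Data.Nat using (ℕ; _+_; _*_; _∸_; _≤_)
open import Data.List using (List)
open import Data.Product using (_×_)
open import Relation.Binary.PropositionalEquality using (_≡_)

open import Data.Empty using (⊥; ⊥-elim)
open import Data.List using ([]; _∷_; [_]; _++_; map; filter; length; reverse; applyUpTo; upTo)
open import Data.List.Membership.Propositional using (_∈_; _∉_)
open import Data.List.Membership.Propositional.Properties using (foldr-selective; ∈-++⁺ˡ; ∈-++⁺ʳ; ∈-applyUpTo⁺)
open import Data.List.Properties
  using (map-id; map-∘; unfold-reverse; length-reverse; length-++; filter-reject; filter-all; foldr-preservesᵇ; foldr-forcesᵇ)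
open import Data.List.Relation.Binary.Permutation.Propositional.Properties as Perm using (↭-reverse)
open import Data.List.Relation.Unary.All as All using (All; []; _∷_)
import Data.List.Relation.Unary.All.Properties as All
open import Data.List.Relation.Unary.AllPairs as AllPairs using ([]; _∷_)
import Data.List.Relation.Unary.AllPairs.Properties as AllPairs
open import Data.List.Relation.Unary.Any using (here; there)
open import Data.List.Relation.Unary.Linked as Linked using (Linked)
open import Data.List.Relation.Unary.Linked.Properties using (Linked⇒AllPairs; AllPairs⇒Linked)
open import Data.List.Relation.Unary.Unique.Propositional using (Unique)
open import Data.Nat using (zero; suc; _<_; _≤?_; _<?_; _≟_; _/_; _%_; s≤s; z≤n)
open import Data.List.Membership.DecPropositional _≟_ using (_∈?_)
open import Data.Nat.DivMod using (m≡m%n+[m/n]*n; m%n<n; m*n/n≡m)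
open import Data.Nat.ListAction using (sum)
open import Data.Nat.ListAction.Properties using (sum-++; sum-↭)
open import Data.Nat.Properties
open import Algebra.Properties.CommutativeSemigroup +-commutativeSemigroup using (interchange; xy∙z≈xz∙y)
open import Data.Nat.Tactic.RingSolver using (solve-∀)
open import Data.Product using (_,_; proj₁; proj₂; ∃-syntax)
open import Data.Sum as Sum using (_⊎_; inj₁; inj₂; [_,_]′)
open import Function using (_∘_)
open import Function.Bundles using (_⇔_; mk⇔; Equivalence)
open import Relation.Binary using (tri<; tri≈; tri>)
open import Relation.Binary.PropositionalEquality using (_≢_; refl; sym; trans; cong; cong₂; subst; module ≡-Reasoning)
open import Relation.Nullary using (Dec; yes; no; ¬_; ¬?)
open import Relation.Unary using (Decidable)

open Equivalence using (to; from)

-- Put c = n − 2, so that T n = (c + 2)(c + 3)/2.  The partition {1, …, c − 1, c + 3, 2c} is an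
-- unrefinable partition of T n, so a maximal λ has largest part L ≥ 2c.  Conversely a + 1 and
-- L − (a + 1) cannot both be missing from an unrefinable λ, and summing over these pairs bounds
-- the sum of λ from below; this excludes L = 2c + 1, L = 2c + 2 and L ≥ 2c + 3.  When L = 2c and
-- λ has c missing parts the same pairing is tight: c is missing and, for x ≠ c, exactly one of
-- x and 2c − x is a part.  Reflecting by x ↦ 2c − x then counts the gaps below a part g as the
-- parts y with y + g > 2c, plus one if g > c.  Hence the row of the i-th largest part g has
-- C_i + 1 cells when g > c and C_(i+1) cells when g < c, and the hook condition h_(1,z+1) = n − 2
-- says exactly that z is the number of parts larger than c.

𝟙 : {A : Set} → Dec A → ℕ
𝟙 (yes _) = 1
𝟙 (no _)  = 0

𝟙≤1 : {A : Set} (a? : Dec A) → 𝟙 a? ≤ 1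
𝟙≤1 (yes _) = s≤s z≤n
𝟙≤1 (no _)  = z≤n

𝟙-mono : {A B : Set} (a? : Dec A) (b? : Dec B) → (A → B) → 𝟙 a? ≤ 𝟙 b?
𝟙-mono (yes a) (yes _) _   = ≤-refl
𝟙-mono (yes a) (no ¬b) A→B = ⊥-elim (¬b (A→B a))
𝟙-mono (no _)  _       _   = z≤n

𝟙-cong : {A B : Set} (a? : Dec A) (b? : Dec B) → (A → B) → (B → A) → 𝟙 a? ≡ 𝟙 b?
𝟙-cong a? b? A→B B→A = ≤-antisym (𝟙-mono a? b? A→B) (𝟙-mono b? a? B→A)

𝟙-yes : {A : Set} (a? : Dec A) → A → 𝟙 a? ≡ 1
𝟙-yes (yes _) _ = refl
𝟙-yes (no ¬a) a = ⊥-elim (¬a a)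

𝟙-no : {A : Set} (a? : Dec A) → ¬ A → 𝟙 a? ≡ 0
𝟙-no (yes a) ¬a = ⊥-elim (¬a a)
𝟙-no (no _)  _  = refl

∑< : ℕ → (ℕ → ℕ) → ℕ
∑< zero    f = 0
∑< (suc n) f = ∑< n f + f n

syntax ∑< n (λ x → e) = ∑[ x < n ] e

module _ {f g : ℕ → ℕ} where

  ∑-cong : ∀ n → (∀ x → x < n → f x ≡ g x) → ∑< n f ≡ ∑< n g
  ∑-cong zero    _   = refl
  ∑-cong (suc n) f≡g = cong₂ _+_ (∑-cong n (λ x x<n → f≡g x (m<n⇒m<1+n x<n))) (f≡g n ≤-refl)

  ∑-mono-≤ : ∀ n → (∀ x → x < n → f x ≤ g x) → ∑< n f ≤ ∑< n g
  ∑-mono-≤ zero    _   = z≤n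
  ∑-mono-≤ (suc n) f≤g = +-mono-≤ (∑-mono-≤ n (λ x x<n → f≤g x (m<n⇒m<1+n x<n))) (f≤g n ≤-refl)

  ∑-distrib-+ : ∀ n → ∑[ x < n ] (f x + g x) ≡ ∑< n f + ∑< n g
  ∑-distrib-+ zero    = refl
  ∑-distrib-+ (suc n) = trans (cong (_+ (f n + g n)) (∑-distrib-+ n))
    (interchange (∑< n f) (∑< n g) (f n) (g n))

∑-suc : ∀ n (f : ℕ → ℕ) → ∑< (suc n) f ≡ f 0 + ∑< n (f ∘ suc)
∑-suc zero    f = +-comm 0 (f 0)
∑-suc (suc n) f = trans (cong (_+ f (suc n)) (∑-suc n f)) (+-assoc (f 0) _ (f (suc n)))

∑-split : ∀ m n (f : ℕ → ℕ) → ∑< (m + n) f ≡ ∑< m f + ∑[ x < n ] f (m + x)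
∑-split m zero    f = trans (cong (λ k → ∑< k f) (+-identityʳ m)) (sym (+-identityʳ _))
∑-split m (suc n) f = begin
  ∑< (m + suc n) f                          ≡⟨ cong (λ k → ∑< k f) (+-suc m n) ⟩
  ∑< (m + n) f + f (m + n)                  ≡⟨ cong (_+ f (m + n)) (∑-split m n f) ⟩
  ∑< m f + ∑[ x < n ] f (m + x) + f (m + n) ≡⟨ +-assoc (∑< m f) _ _ ⟩
  ∑< m f + ∑[ x < suc n ] f (m + x)         ∎
  where open ≡-Reasoning

∑-reverse : ∀ n (f : ℕ → ℕ) → ∑< n f ≡ ∑[ x < n ] f (n ∸ suc x)
∑-reverse zero    f = refl
∑-reverse (suc n) f = begin
  ∑< n f + f n                           ≡⟨ cong (_+ f n) (∑-reverse n f) ⟩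
  ∑[ x < n ] f (n ∸ suc x) + f n         ≡⟨ +-comm _ (f n) ⟩
  f n + ∑[ x < n ] f (n ∸ suc x)         ≡⟨ sym (∑-suc n (λ x → f (suc n ∸ suc x))) ⟩
  ∑[ x < suc n ] f (suc n ∸ suc x)       ∎
  where open ≡-Reasoning

∑-zero : ∀ n {f : ℕ → ℕ} → (∀ x → x < n → f x ≡ 0) → ∑< n f ≡ 0
∑-zero zero    _    = refl
∑-zero (suc n) f≡0 = cong₂ _+_ (∑-zero n (λ x x<n → f≡0 x (m<n⇒m<1+n x<n))) (f≡0 n ≤-refl)

∑-const-1 : ∀ n → ∑[ _ < n ] 1 ≡ n
∑-const-1 zero    = refl
∑-const-1 (suc n) = trans (cong (_+ 1) (∑-const-1 n)) (+-comm n 1)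

term≤∑ : ∀ n (f : ℕ → ℕ) {a} → a < n → f a ≤ ∑< n f
term≤∑ (suc n) f {a} a<1+n with m<1+n⇒m<n∨m≡n a<1+n
... | inj₁ a<n  = ≤-trans (term≤∑ n f a<n) (m≤m+n _ _)
... | inj₂ refl = m≤n+m (f a) (∑< n f)

∑-select : ∀ n (h : ℕ → ℕ) {a} → a < n → ∑[ x < n ] (𝟙 (x ≟ a) * h x) ≡ h a
∑-select (suc n) h {a} a<1+n with m<1+n⇒m<n∨m≡n a<1+n | n ≟ a
... | inj₁ a<n  | no _     = trans (+-identityʳ _) (∑-select n h a<n)
... | inj₁ a<n  | yes refl = ⊥-elim (<-irrefl refl a<n)
... | inj₂ refl | yes _    = cong₂ _+_ (∑-zero n off) (+-identityʳ (h n))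
  where
  off : ∀ x → x < n → 𝟙 (x ≟ n) * h x ≡ 0
  off x x<n = cong (_* h x) (𝟙-no (x ≟ n) (<⇒≢ x<n))
... | inj₂ refl | no n≢n   = ⊥-elim (n≢n refl)

∑-restrict : ∀ {g n} (f : ℕ → ℕ) → g ≤ n → ∑< g f ≡ ∑[ x < n ] (f x * 𝟙 (x <? g))
∑-restrict {g} f g≤n with o , refl ← m≤n⇒∃[o]m+o≡n g≤n = begin
  ∑< g f                                                                ≡⟨ +-identityʳ (∑< g f) ⟨
  ∑< g f + 0                                                            ≡⟨ cong₂ _+_ (∑-cong g inside) (sym (∑-zero o outside)) ⟩
  ∑[ x < g ] (f x * 𝟙 (x <? g)) + ∑[ x < o ] (f (g + x) * 𝟙 (g + x <? g)) ≡⟨ sym (∑-split g o (λ x → f x * 𝟙 (x <? g))) ⟩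
  ∑[ x < g + o ] (f x * 𝟙 (x <? g))                                     ∎
  where
  open ≡-Reasoning
  inside : ∀ x → x < g → f x ≡ f x * 𝟙 (x <? g)
  inside x x<g = sym (trans (cong (f x *_) (𝟙-yes (x <? g) x<g)) (*-identityʳ (f x)))
  outside : ∀ x → x < o → f (g + x) * 𝟙 (g + x <? g) ≡ 0
  outside x _ = trans (cong (f (g + x) *_) (𝟙-no (g + x <? g) (≤⇒≯ (m≤m+n g x)))) (*-zeroʳ (f (g + x)))

∑-zero-or-≥ : ∀ t n (f : ℕ → ℕ) → (∀ x → x < n → f x ≡ 0 ⊎ t ≤ f x) → ∑< n f ≡ 0 ⊎ t ≤ ∑< n f
∑-zero-or-≥ t zero    f _ = inj₁ refl
∑-zero-or-≥ t (suc n) f h with ∑-zero-or-≥ t n f (λ x x<n → h x (m<n⇒m<1+n x<n)) | h n ≤-refl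
... | inj₁ ∑≡0 | inj₁ fn≡0 = inj₁ (cong₂ _+_ ∑≡0 fn≡0)
... | inj₁ _   | inj₂ t≤fn = inj₂ (≤-trans t≤fn (m≤n+m _ _))
... | inj₂ t≤∑ | _         = inj₂ (≤-trans t≤∑ (m≤m+n _ _))

∑≤1⇒≤n : ∀ n (f : ℕ → ℕ) → (∀ x → x < n → f x ≤ 1) → ∑< n f ≤ n
∑≤1⇒≤n n f f≤1 = ≤-trans (∑-mono-≤ n f≤1) (≤-reflexive (∑-const-1 n))

∑≤1-≡n⇒≡1 : ∀ n (f : ℕ → ℕ) → (∀ x → x < n → f x ≤ 1) → ∑< n f ≡ n → ∀ x → x < n → f x ≡ 1
∑≤1-≡n⇒≡1 (suc n) f f≤1 ∑≡1+n x x<1+n = go (m<1+n⇒m<n∨m≡n x<1+n)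
  where
  f≤1′ : ∀ x → x < n → f x ≤ 1
  f≤1′ x x<n = f≤1 x (m<n⇒m<1+n x<n)
  tight : ∀ {a b} → a ≤ n → b ≤ 1 → a + b ≡ suc n → a ≡ n × b ≡ 1
  tight {a} {0} a≤n _ a+0≡1+n = ⊥-elim (1+n≰n (subst (_≤ n) (trans (sym (+-identityʳ a)) a+0≡1+n) a≤n))
  tight {a} {1} _   _ a+1≡1+n = +-cancelʳ-≡ 1 a n (trans a+1≡1+n (+-comm 1 n)) , refl
  tight {b = suc (suc _)} _ (s≤s ()) _
  prefix,last : ∑< n f ≡ n × f n ≡ 1
  prefix,last = tight (∑≤1⇒≤n n f f≤1′) (f≤1 n ≤-refl) ∑≡1+n
  go : x < n ⊎ x ≡ n → f x ≡ 1
  go (inj₁ x<n) = ∑≤1-≡n⇒≡1 n f f≤1′ (proj₁ prefix,last) x x<n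
  go (inj₂ refl) = proj₂ prefix,last

2*∑[1+x]≡n*[1+n] : ∀ n → 2 * ∑[ x < n ] suc x ≡ n * suc n
2*∑[1+x]≡n*[1+n] zero    = refl
2*∑[1+x]≡n*[1+n] (suc n) = begin
  2 * (∑[ x < n ] suc x + suc n)     ≡⟨ *-distribˡ-+ 2 (∑[ x < n ] suc x) (suc n) ⟩
  2 * ∑[ x < n ] suc x + 2 * suc n   ≡⟨ cong (_+ 2 * suc n) (2*∑[1+x]≡n*[1+n] n) ⟩
  n * suc n + 2 * suc n              ≡⟨ step n ⟩
  suc n * suc (suc n)                ∎
  where
  open ≡-Reasoning
  step : ∀ n → n * suc n + 2 * suc n ≡ suc n * suc (suc n)
  step = solve-∀

2*T≡n*[1+n] : ∀ n → 2 * T n ≡ n * suc n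
2*T≡n*[1+n] n = begin
  2 * T n                          ≡⟨ cong (λ m → 2 * (m / 2)) n*[n+1]≡ ⟩
  2 * ((∑[ x < n ] suc x * 2) / 2) ≡⟨ cong (2 *_) (m*n/n≡m (∑[ x < n ] suc x) 2) ⟩
  2 * ∑[ x < n ] suc x             ≡⟨ 2*∑[1+x]≡n*[1+n] n ⟩
  n * suc n                        ∎
  where
  open ≡-Reasoning
  n*[n+1]≡ : n * (n + 1) ≡ ∑[ x < n ] suc x * 2
  n*[n+1]≡ = trans (cong (n *_) (+-comm n 1)) (trans (sym (2*∑[1+x]≡n*[1+n] n)) (*-comm 2 (∑[ x < n ] suc x)))

∑-pairUp : ∀ m e (f : ℕ → ℕ) → ∑< (suc (m + e + m)) f
         ≡ f 0 + (∑[ a < m ] (f (suc a) + f (m + e + m ∸ a)) + ∑[ a < e ] f (suc m + a))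
∑-pairUp m e f = begin
  ∑< (suc (m + e + m)) f                 ≡⟨ ∑-suc (m + e + m) f ⟩
  f 0 + ∑< (m + e + m) (f ∘ suc)         ≡⟨ cong (f 0 +_) (∑-split (m + e) m (f ∘ suc)) ⟩
  f 0 + (∑< (m + e) (f ∘ suc) + Hi)      ≡⟨ cong (λ t → f 0 + (t + Hi)) (∑-split m e (f ∘ suc)) ⟩
  f 0 + ((Lo + Mid) + Hi)                ≡⟨ cong (λ t → f 0 + ((Lo + Mid) + t)) reflect-Hi ⟩
  f 0 + ((Lo + Mid) + Hi′)               ≡⟨ cong (f 0 +_) (xy∙z≈xz∙y Lo Mid Hi′) ⟩
  f 0 + ((Lo + Hi′) + Mid)               ≡⟨ cong (λ t → f 0 + (t + Mid)) (sym (∑-distrib-+ m)) ⟩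
  f 0 + (∑[ a < m ] (f (suc a) + f (m + e + m ∸ a)) + Mid) ∎
  where
  open ≡-Reasoning
  Lo  = ∑< m (f ∘ suc)
  Mid = ∑[ a < e ] f (suc m + a)
  Hi  = ∑[ x < m ] f (suc (m + e + x))
  Hi′ = ∑[ a < m ] f (m + e + m ∸ a)
  reflect-Hi : Hi ≡ Hi′
  reflect-Hi = trans (∑-reverse m _) (∑-cong m (λ a a<m → cong f (index a a<m)))
    where
    index : ∀ a → a < m → suc (m + e + (m ∸ suc a)) ≡ m + e + m ∸ a
    index a a<m = begin
      suc (m + e + (m ∸ suc a)) ≡⟨ sym (+-suc (m + e) (m ∸ suc a)) ⟩
      m + e + suc (m ∸ suc a)   ≡⟨ cong (m + e +_) (sym (+-∸-assoc 1 a<m)) ⟩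
      m + e + (m ∸ a)           ≡⟨ sym (+-∸-assoc (m + e) (<⇒≤ a<m)) ⟩
      m + e + m ∸ a             ∎

χ : List ℕ → ℕ → ℕ
χ xs x = 𝟙 (x ∈? xs)

μ : List ℕ → ℕ → ℕ
μ xs x = 𝟙 (¬? (x ∈? xs))

χ+μ≡1 : ∀ xs x → χ xs x + μ xs x ≡ 1
χ+μ≡1 xs x with x ∈? xs
... | yes _ = refl
... | no _  = refl

χ-∷ : ∀ {y ys} → y ∉ ys → ∀ x → χ (y ∷ ys) x ≡ 𝟙 (x ≟ y) + χ ys x
χ-∷ {y} {ys} y∉ys x with x ≟ y | x ∈? ys | x ∈? (y ∷ ys)
... | yes refl | yes x∈ys | _              = ⊥-elim (y∉ys x∈ys)
... | yes refl | no _     | yes _          = refl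
... | yes refl | no _     | no x∉          = ⊥-elim (x∉ (here refl))
... | no _     | yes _    | yes _          = refl
... | no _     | yes x∈ys | no x∉          = ⊥-elim (x∉ (there x∈ys))
... | no x≢y   | _        | yes (here x≡y) = ⊥-elim (x≢y x≡y)
... | no _     | no x∉ys  | yes (there x∈ys) = ⊥-elim (x∉ys x∈ys)
... | no _     | no _     | no _           = refl

head<tail : ∀ {x xs} → Linked _<_ (x ∷ xs) → All (x <_) xs
head<tail = AllPairs.head ∘ Linked⇒AllPairs <-trans

exactly-one : ∀ {xs x y} → μ xs x + μ xs y ≡ 1 → x ∈ xs ⇔ y ∉ xs
exactly-one {xs} {x} {y} one with x ∈? xs | y ∈? xs
... | yes _   | yes _   = ⊥-elim (0≢1+n one)
... | yes x∈  | no y∉   = mk⇔ (λ _ → y∉) (λ _ → x∈)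
... | no x∉   | yes y∈  = mk⇔ (λ x∈ → ⊥-elim (x∉ x∈)) (λ y∉ → ⊥-elim (y∉ y∈))
... | no _    | no _    = ⊥-elim (1+n≢0 (suc-injective one))

increasing⇒unique : ∀ {xs} → Linked _<_ xs → Unique xs
increasing⇒unique = AllPairs.map <⇒≢ ∘ Linked⇒AllPairs <-trans

sum-map≡∑ : ∀ {xs} B → Unique xs → All (_< B) xs → (h : ℕ → ℕ) →
            sum (map h xs) ≡ ∑[ x < B ] (χ xs x * h x)
sum-map≡∑ {[]}     B _                _           h = sym (∑-zero B (λ _ _ → refl))
sum-map≡∑ {y ∷ ys} B (y≢ys ∷ uniq) (y<B ∷ ys<B) h = begin
  h y + sum (map h ys)                                   ≡⟨ cong₂ _+_ (sym (∑-select B h y<B)) (sum-map≡∑ B uniq ys<B h) ⟩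
  ∑[ x < B ] (𝟙 (x ≟ y) * h x) + ∑[ x < B ] (χ ys x * h x) ≡⟨ sym (∑-distrib-+ B) ⟩
  ∑[ x < B ] (𝟙 (x ≟ y) * h x + χ ys x * h x)           ≡⟨ ∑-cong B (λ x _ → pointwise x) ⟩
  ∑[ x < B ] (χ (y ∷ ys) x * h x)                        ∎
  where
  open ≡-Reasoning
  y∉ys : y ∉ ys
  y∉ys y∈ys = All.lookup y≢ys y∈ys refl
  pointwise : ∀ x → 𝟙 (x ≟ y) * h x + χ ys x * h x ≡ χ (y ∷ ys) x * h x
  pointwise x = sym (trans (cong (_* h x) (χ-∷ y∉ys x)) (*-distribʳ-+ (h x) (𝟙 (x ≟ y)) (χ ys x)))

length≡∑χ : ∀ {xs} B → Unique xs → All (_< B) xs → length xs ≡ ∑< B (χ xs)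
length≡∑χ {xs} B uniq xs<B = begin
  length xs                    ≡⟨ sym (length-as-sum xs) ⟩
  sum (map (λ _ → 1) xs)       ≡⟨ sum-map≡∑ B uniq xs<B (λ _ → 1) ⟩
  ∑[ x < B ] (χ xs x * 1)      ≡⟨ ∑-cong B (λ x _ → *-identityʳ (χ xs x)) ⟩
  ∑< B (χ xs)                  ∎
  where
  open ≡-Reasoning
  length-as-sum : ∀ (xs : List ℕ) → sum (map (λ _ → 1) xs) ≡ length xs
  length-as-sum []       = refl
  length-as-sum (_ ∷ xs) = cong suc (length-as-sum xs)

length-filter≡sum-map : ∀ {P : ℕ → Set} (P? : Decidable P) xs →
                        length (filter P? xs) ≡ sum (map (𝟙 ∘ P?) xs)
length-filter≡sum-map P? []       = refl
length-filter≡sum-map P? (x ∷ xs) with P? x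
... | yes _ = cong suc (length-filter≡sum-map P? xs)
... | no _  = length-filter≡sum-map P? xs

map-applyUpTo : ∀ (f g : ℕ → ℕ) n → map f (applyUpTo g n) ≡ applyUpTo (f ∘ g) n
map-applyUpTo f g zero    = refl
map-applyUpTo f g (suc n) = cong (f (g 0) ∷_) (map-applyUpTo f (g ∘ suc) n)

sum-applyUpTo : ∀ (f : ℕ → ℕ) n → sum (applyUpTo f n) ≡ ∑< n f
sum-applyUpTo f zero    = refl
sum-applyUpTo f (suc n) = trans (cong (f 0 +_) (sum-applyUpTo (f ∘ suc) n)) (sym (∑-suc n f))


sum-map-reverse : ∀ (h : ℕ → ℕ) xs → sum (map h (reverse xs)) ≡ sum (map h xs)
sum-map-reverse h xs = sum-↭ (Perm.map⁺ h (↭-reverse xs))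

at-map : ∀ (f : ℕ → ℕ) → f 0 ≡ 0 → ∀ xs i → at (map f xs) i ≡ f (at xs i)
at-map f f0≡0 []       i             = sym f0≡0
at-map f f0≡0 (x ∷ xs) zero          = sym f0≡0
at-map f f0≡0 (x ∷ xs) (suc zero)    = refl
at-map f f0≡0 (x ∷ xs) (suc (suc i)) = at-map f f0≡0 xs (suc i)

at-++ˡ : ∀ ys zs {i} → 1 ≤ i → i ≤ length ys → at (ys ++ zs) i ≡ at ys i
at-++ˡ (y ∷ ys) zs {suc zero}    _ _          = refl
at-++ˡ (y ∷ ys) zs {suc (suc i)} _ (s≤s i<∣ys∣) = at-++ˡ ys zs (s≤s z≤n) i<∣ys∣

at-∷ʳ : ∀ ys x → at (ys ++ [ x ]) (suc (length ys)) ≡ x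
at-∷ʳ []       x = refl
at-∷ʳ (y ∷ ys) x = at-∷ʳ ys x

ith-largest : ∀ {xs} → Linked _<_ xs → ∀ {i} → 1 ≤ i → i ≤ length xs →
              at (reverse xs) i ∈ xs × length (filter (at (reverse xs) i ≤?_) xs) ≡ i
ith-largest {[]}     _    {suc _} _   ()
ith-largest {x ∷ xs} x<xs {i} 1≤i i≤1+∣xs∣ rewrite unfold-reverse x xs with m≤n⇒m<n∨m≡n i≤1+∣xs∣
... | inj₁ (s≤s i≤∣xs∣)
  rewrite at-++ˡ (reverse xs) [ x ] 1≤i (subst (i ≤_) (sym (length-reverse xs)) i≤∣xs∣)
  with g∈xs , rank ← ith-largest (Linked.tail x<xs) 1≤i i≤∣xs∣
  = there g∈xs , trans (cong length (filter-reject (_ ≤?_) (<⇒≱ (All.lookup (head<tail x<xs) g∈xs)))) rank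
... | inj₂ refl
  rewrite subst (λ n → at (reverse xs ++ [ x ]) (suc n) ≡ x) (length-reverse xs) (at-∷ʳ (reverse xs) x)
  = here refl , cong length (filter-all (x ≤?_) (≤-refl ∷ All.map <⇒≤ (head<tail x<xs)))

largest-≤ : ∀ {b xs} → All (_≤ b) xs → largest xs ≤ b
largest-≤ = foldr-preservesᵇ ⊔-lub z≤n

≤-largest : ∀ xs → All (_≤ largest xs) xs
≤-largest xs = foldr-forcesᵇ (λ m n m⊔n≤ → m⊔n≤o⇒m≤o m n m⊔n≤ , m⊔n≤o⇒n≤o m n m⊔n≤) 0 xs ≤-refl

largest∈ : ∀ xs → 1 ≤ largest xs → largest xs ∈ xs
largest∈ xs 1≤L with foldr-selective ⊔-sel 0 xs
... | inj₁ L≡0 = ⊥-elim (1+n≰n (subst (1 ≤_) L≡0 1≤L))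
... | inj₂ L∈xs = L∈xs

summands-of-largest-not-both-missing : ∀ {ps} → Unrefinable ps → largest ps ∈ ps →
  ∀ {x y} → 1 ≤ x → x < y → x + y ≡ largest ps → x ∉ ps → y ∉ ps → ⊥
summands-of-largest-not-both-missing {ps} unrefinable L∈ {x} {y} 1≤x x<y x+y≡L x∉ y∉ =
  unrefinable x y (<⇒≢ x<y) (1≤x , x≤L , x∉) (≤-trans 1≤x (<⇒≤ x<y) , y≤L , y∉) (subst (_∈ ps) (sym x+y≡L) L∈)
  where
  x≤L = subst (x ≤_) x+y≡L (m≤m+n x y)
  y≤L = subst (y ≤_) x+y≡L (m≤n+m y x)

-- An unrefinable partition of T (c + 2) with largest part 2c

module _ (c′ : ℕ) (4≤c : 4 ≤ suc c′) where

  private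
    c = suc c′

  largest-2c-witness : List ℕ
  largest-2c-witness = applyUpTo suc c′ ++ c + 3 ∷ c + c ∷ []

  private
    W = largest-2c-witness

    c+3<2c : c + 3 < c + c
    c+3<2c = +-monoʳ-< c 4≤c

    increasing : Linked _<_ W
    increasing = AllPairs⇒Linked (AllPairs.++⁺
      (AllPairs.applyUpTo⁺₁ suc c′ (λ i<j _ → s≤s i<j))
      ((c+3<2c ∷ []) ∷ [] ∷ [])
      (All.applyUpTo⁺₁ suc c′ (λ i<c′ → ≤-trans (s≤s i<c′) (m≤m+n c 3) ∷ ≤-trans (s≤s i<c′) (m≤m+n c c) ∷ [])))

    positive : All (1 ≤_) W
    positive = All.++⁺ (All.applyUpTo⁺₂ suc c′ (λ _ → s≤s z≤n)) (s≤s z≤n ∷ s≤s z≤n ∷ [])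

    two-parts : 2 ≤ length W
    two-parts = subst (2 ≤_) (sym (length-++ (applyUpTo suc c′))) (m≤n+m 2 _)

    ≤2c : All (_≤ c + c) W
    ≤2c = All.++⁺ (All.applyUpTo⁺₁ suc c′ (λ i<c′ → ≤-trans (s≤s (<⇒≤ i<c′)) (m≤m+n c c)))
                  (<⇒≤ c+3<2c ∷ ≤-refl ∷ [])

    2c∈ : c + c ∈ W
    2c∈ = ∈-++⁺ʳ (applyUpTo suc c′) (there (here refl))

    missing≥c : ∀ {m} → Missing W m → c ≤ m
    missing≥c {zero}  (() , _)
    missing≥c {suc i} (_ , _ , m∉W) with c ≤? suc i
    ... | yes c≤m = c≤m
    ... | no  c≰m = ⊥-elim (m∉W (∈-++⁺ˡ (∈-applyUpTo⁺ suc (≤-pred (≰⇒> c≰m)))))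

    unrefinable : Unrefinable W
    unrefinable a b a≢b a-missing b-missing a+b∈W =
      <⇒≱ 2c<a+b (All.lookup ≤2c a+b∈W)
      where
      2c<a+b : c + c < a + b
      2c<a+b with m≤n⇒m<n∨m≡n (missing≥c a-missing)
      ... | inj₁ c<a  = +-mono-<-≤ c<a (missing≥c b-missing)
      ... | inj₂ refl = +-monoʳ-< c (≤∧≢⇒< (missing≥c b-missing) a≢b)

    2*sum : 2 * sum W ≡ (c + 2) * (c + 3)
    2*sum = begin
      2 * sum W                                      ≡⟨ cong (2 *_) sum≡ ⟩
      2 * (∑< c′ suc + top)                          ≡⟨ *-distribˡ-+ 2 (∑< c′ suc) top ⟩
      2 * ∑< c′ suc + 2 * top                        ≡⟨ cong (_+ 2 * top) (2*∑[1+x]≡n*[1+n] c′) ⟩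
      c′ * suc c′ + 2 * (c + 3 + (c + c + 0))        ≡⟨ arith c′ ⟩
      (c + 2) * (c + 3)                              ∎
      where
      open ≡-Reasoning
      top = c + 3 + (c + c + 0)
      sum≡ : sum W ≡ ∑< c′ suc + top
      sum≡ = trans (sum-++ (applyUpTo suc c′) (c + 3 ∷ c + c ∷ [])) (cong (_+ top) (sum-applyUpTo suc c′))
      arith : ∀ c′ → c′ * suc c′ + 2 * (suc c′ + 3 + (suc c′ + suc c′ + 0)) ≡ (suc c′ + 2) * (suc c′ + 3)
      arith = solve-∀

  unrefinable-with-largest-2c : ∀ {N} → 2 * N ≡ (c + 2) * (c + 3) →
                                ∃[ ps ] UnrefPartOf N ps × largest ps ≡ c + c
  unrefinable-with-largest-2c 2N≡ =
    W , ((increasing , positive , two-parts) , unrefinable , *-cancelˡ-≡ _ _ 2 (trans 2*sum (sym 2N≡))) ,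
    ≤-antisym (largest-≤ ≤2c) (All.lookup (≤-largest W) 2c∈)

-- The largest part of an unrefinable partition of T (c + 2)

halves : ∀ n → ∃[ m ] ∃[ e ] e ≤ 1 × n ≡ m + e + m
halves n = n / 2 , n % 2 , ≤-pred (m%n<n n 2) , trans (m≡m%n+[m/n]*n n 2) (arith (n % 2) (n / 2))
  where
  arith : ∀ e m → e + m * 2 ≡ m + e + m
  arith = solve-∀

zero-or-≥2-≢1 : ∀ {X Y} → X ≡ 0 ⊎ 2 ≤ X → Y ≡ 0 ⊎ 2 ≤ Y → X + Y ≢ 1
zero-or-≥2-≢1 (inj₁ refl) (inj₁ refl) ()
zero-or-≥2-≢1 (inj₁ refl) (inj₂ 2≤Y) Y≡1 = <⇒≱ (s≤s (s≤s z≤n)) (subst (2 ≤_) Y≡1 2≤Y)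
zero-or-≥2-≢1 {X} {Y} (inj₂ 2≤X) _ X+Y≡1 = <⇒≱ (s≤s (s≤s z≤n)) (subst (2 ≤_) X+Y≡1 (≤-trans 2≤X (m≤m+n X Y)))

module LargestPartBound {ps : List ℕ} (increasing : Linked _<_ ps) (unrefinable : Unrefinable ps)
                        (L∈ : largest ps ∈ ps) where

  private
    L = largest ps

  size : ℕ → ℕ
  size x = χ ps x * x

  size-L : size L ≡ L
  size-L = trans (cong (_* L) (𝟙-yes (L ∈? ps) L∈)) (*-identityˡ L)

  sum≡∑size : sum ps ≡ ∑< (suc L) size
  sum≡∑size = trans (cong sum (sym (map-id ps)))
    (sum-map≡∑ (suc L) (increasing⇒unique increasing) (All.map s≤s (≤-largest ps)) (λ x → x))

  module Pairs (m e : ℕ) (L≡ : L ≡ suc (m + e + m)) where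

    gap : ℕ → ℕ
    gap a = (m ∸ suc a) + e + suc (m ∸ suc a)

    partner≡ : ∀ {a} → a < m → m + e + m ∸ a ≡ suc a + gap a
    partner≡ {a} a<m = begin
      m + e + m ∸ a                               ≡⟨ cong (λ k → k + e + k ∸ a) m≡ ⟩
      (suc a + d) + e + (suc a + d) ∸ a           ≡⟨ cong (_∸ a) (arith a d e) ⟩
      a + (suc a + gap a) ∸ a                     ≡⟨ m+n∸m≡n a _ ⟩
      suc a + gap a                               ∎
      where
      open ≡-Reasoning
      d = m ∸ suc a
      m≡ : m ≡ suc a + d
      m≡ = sym (m+[n∸m]≡n a<m)
      arith : ∀ a d e → (suc a + d) + e + (suc a + d) ≡ a + (suc a + (d + e + suc d))
      arith = solve-∀

    pair-cases : ∀ {a} → a < m → let P = size (suc a) + size (m + e + m ∸ a) in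
                 P ≡ suc a + 0 ⊎ P ≡ suc a + gap a ⊎ P ≡ suc a + (suc a + gap a)
    pair-cases {a} a<m with suc a ∈? ps | (m + e + m ∸ a) ∈? ps
    ... | yes _ | yes _ = inj₂ (inj₂ (cong₂ _+_ (+-identityʳ (suc a)) (trans (+-identityʳ _) (partner≡ a<m))))
    ... | yes _ | no _  = inj₁ (+-identityʳ _)
    ... | no _  | yes _ = inj₂ (inj₁ (trans (+-identityʳ _) (partner≡ a<m)))
    ... | no x∉ | no y∉ = ⊥-elim (summands-of-largest-not-both-missing unrefinable L∈ (s≤s z≤n) x<y x+y≡L x∉ y∉)
      where
      x<y : suc a < m + e + m ∸ a
      x<y = subst (suc a <_) (sym (partner≡ a<m)) (m<m+n (suc a) (≤-trans (s≤s z≤n) (m≤n+m _ (m ∸ suc a + e))))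
      a≤M : a ≤ m + e + m
      a≤M = ≤-trans (<⇒≤ a<m) (≤-trans (m≤m+n m e) (m≤m+n (m + e) m))
      x+y≡L : suc a + (m + e + m ∸ a) ≡ L
      x+y≡L = trans (cong suc (m+[n∸m]≡n a≤M)) (sym L≡)

    excess : ℕ → ℕ
    excess a = size (suc a) + size (m + e + m ∸ a) ∸ suc a

    middle : ℕ
    middle = ∑[ a < e ] size (suc m + a)

    private
      excess≡ : ∀ {a t} → size (suc a) + size (m + e + m ∸ a) ≡ suc a + t → excess a ≡ t
      excess≡ {a} P≡ = trans (cong (_∸ suc a) P≡) (m+n∸m≡n (suc a) _)

    excess-cases : ∀ {a} → a < m → excess a ≡ 0 ⊎ excess a ≡ gap a ⊎ excess a ≡ suc a + gap a
    excess-cases a<m = Sum.map excess≡ (Sum.map excess≡ excess≡) (pair-cases a<m)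

    excess-zero-or-≥gap : ∀ {a} → a < m → excess a ≡ 0 ⊎ gap a ≤ excess a
    excess-zero-or-≥gap {a} a<m = Sum.map₂ [ ≤-reflexive ∘ sym , (λ e≡ → subst (gap a ≤_) (sym e≡) (m≤n+m _ (suc a))) ]′
                                           (excess-cases a<m)

    pair≡ : ∀ {a} → a < m → size (suc a) + size (m + e + m ∸ a) ≡ suc a + excess a
    pair≡ {a} a<m = [ via , [ via , via ]′ ]′ (pair-cases a<m)
      where
      via : ∀ {t} → size (suc a) + size (m + e + m ∸ a) ≡ suc a + t →
            size (suc a) + size (m + e + m ∸ a) ≡ suc a + excess a
      via P≡ = trans P≡ (cong (suc a +_) (sym (excess≡ P≡)))

    2*sum≡ : 2 * sum ps ≡ 2 * L + (m * suc m + 2 * (∑< m excess + middle))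
    2*sum≡ = begin
      2 * sum ps                                              ≡⟨ cong (2 *_) sum≡∑size ⟩
      2 * (∑< L size + size L)                                ≡⟨ cong (λ k → 2 * (∑< k size + size L)) L≡ ⟩
      2 * (∑< (suc (m + e + m)) size + size L)                ≡⟨ cong (λ k → 2 * (k + size L)) (∑-pairUp m e size) ⟩
      2 * (size 0 + (Pairs + middle) + size L)                ≡⟨ cong₂ (λ z l → 2 * (z + (Pairs + middle) + l)) (*-zeroʳ (χ ps 0)) size-L ⟩
      2 * (0 + (Pairs + middle) + L)                          ≡⟨ cong (λ p → 2 * (0 + (p + middle) + L)) pairs≡ ⟩
      2 * (0 + ((∑< m suc + ∑< m excess) + middle) + L)       ≡⟨ arith L (∑< m suc) (∑< m excess) middle ⟩
      2 * L + (2 * ∑< m suc + 2 * (∑< m excess + middle))     ≡⟨ cong (λ k → 2 * L + (k + 2 * (∑< m excess + middle))) (2*∑[1+x]≡n*[1+n] m) ⟩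
      2 * L + (m * suc m + 2 * (∑< m excess + middle))        ∎
      where
      open ≡-Reasoning
      Pairs = ∑[ a < m ] (size (suc a) + size (m + e + m ∸ a))
      pairs≡ : Pairs ≡ ∑< m suc + ∑< m excess
      pairs≡ = trans (∑-cong m (λ a → pair≡)) (∑-distrib-+ m)
      arith : ∀ L S X Y → 2 * (0 + ((S + X) + Y) + L) ≡ 2 * L + (2 * S + 2 * (X + Y))
      arith = solve-∀

    total-excess : ∀ {k} → 2 * sum ps ≡ 2 * L + (m * suc m + 2 * k) → ∑< m excess + middle ≡ k
    total-excess eq = *-cancelˡ-≡ _ _ 2 (+-cancelˡ-≡ (m * suc m) _ _ (+-cancelˡ-≡ (2 * L) _ _ (trans (sym 2*sum≡) eq)))

  private
    -- For L = 2c + 1 the excess totals 2, yet every nonzero excess is at least 3 except that of the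
    -- last pair (c, c + 1), which is 1 or c + 1.
    2c+1-excluded : ∀ c → 2 ≤ c → L ≡ suc (c + c) → 2 * sum ps ≢ (c + 2) * (c + 3)
    2c+1-excluded c@(suc c′) (s≤s 1≤c′) L≡ 2sum≡ = last-excess-options (excess-cases ≤-refl)
      where
      open Pairs c 0 (trans L≡ (cong (λ k → suc (k + c)) (sym (+-identityʳ c))))
      arith : ∀ c → (c + 2) * (c + 3) ≡ 2 * suc (c + c) + (c * suc c + 2 * 2)
      arith = solve-∀
      excess≡2 : ∑< c′ excess + excess c′ + 0 ≡ 2
      excess≡2 = total-excess (trans 2sum≡ (trans (arith c) (cong (λ l → 2 * l + _) (sym L≡))))
      3≤gap : ∀ a → a < c′ → 3 ≤ gap a
      3≤gap a a<c′ = +-mono-≤ (+-mono-≤ 1≤d (z≤n {0})) (s≤s 1≤d)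
        where
        1≤d : 1 ≤ c ∸ suc a
        1≤d = m<n⇒0<n∸m (s≤s a<c′)
      front-zero : ∑< c′ excess ≡ 0
      front-zero with ∑-zero-or-≥ 3 c′ excess (λ a a<c′ →
                        Sum.map₂ (≤-trans (3≤gap a a<c′)) (excess-zero-or-≥gap (m<n⇒m<1+n a<c′)))
      ... | inj₁ ∑≡0 = ∑≡0
      ... | inj₂ 3≤∑ = ⊥-elim (1+n≰n (≤-trans 3≤∑ (subst (∑< c′ excess ≤_) (trans (sym (+-identityʳ _)) excess≡2) (m≤m+n _ _))))
      last≡2 : excess c′ ≡ 2
      last≡2 = trans (sym (+-identityʳ _)) (trans (cong (λ k → k + excess c′ + 0) (sym front-zero)) excess≡2)
      gap-last : gap c′ ≡ 1
      gap-last = cong (λ k → k + 0 + suc k) (n∸n≡0 c′)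
      last-excess-options : excess c′ ≡ 0 ⊎ excess c′ ≡ gap c′ ⊎ excess c′ ≡ suc c′ + gap c′ → ⊥
      last-excess-options (inj₁ e≡0) = 0≢1+n (trans (sym e≡0) last≡2)
      last-excess-options (inj₂ (inj₁ e≡gap)) = 0≢1+n (suc-injective (trans (sym gap-last) (trans (sym e≡gap) last≡2)))
      last-excess-options (inj₂ (inj₂ e≡)) =
        <⇒≢ (+-mono-≤ (s≤s 1≤c′) (≤-reflexive (sym gap-last))) (sym (trans (sym e≡) last≡2))

    2c+2-excluded : ∀ c → 1 ≤ c → L ≡ suc (suc (c + c)) → 2 * sum ps ≢ (c + 2) * (c + 3)
    2c+2-excluded c 1≤c L≡ 2sum≡ = zero-or-≥2-≢1 pairs-excess middle-excess excess≡1
      where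
      shape : ∀ c → suc (c + c) ≡ c + 1 + c
      shape = solve-∀
      open Pairs c 1 (trans L≡ (cong suc (shape c)))
      arith : ∀ c → (c + 2) * (c + 3) ≡ 2 * suc (suc (c + c)) + (c * suc c + 2 * 1)
      arith = solve-∀
      excess≡1 : ∑< c excess + middle ≡ 1
      excess≡1 = total-excess (trans 2sum≡ (trans (arith c) (cong (λ l → 2 * l + _) (sym L≡))))
      2≤gap : ∀ a → 2 ≤ gap a
      2≤gap a = +-mono-≤ (m≤n+m 1 (c ∸ suc a)) (s≤s z≤n)
      pairs-excess : ∑< c excess ≡ 0 ⊎ 2 ≤ ∑< c excess
      pairs-excess = ∑-zero-or-≥ 2 c excess (λ a a<c → Sum.map₂ (≤-trans (2≤gap a)) (excess-zero-or-≥gap a<c))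
      middle-excess : middle ≡ 0 ⊎ 2 ≤ middle
      middle-excess with suc c + 0 ∈? ps
      ... | yes _ = inj₂ (s≤s (≤-trans 1≤c (≤-trans (m≤m+n c 0) (m≤m+n _ 0))))
      ... | no _  = inj₁ refl

    2c+3≤-excluded : ∀ c → suc (suc (suc (c + c))) ≤ L → 2 * sum ps ≢ (c + 2) * (c + 3)
    2c+3≤-excluded c 2c+3≤L 2sum≡ with halves (L ∸ 1)
    ... | m , e , e≤1 , L∸1≡ = <⇒≢ too-small (trans (sym 2sum≡) 2*sum≡)
      where
      L≡ : L ≡ suc (m + e + m)
      L≡ = trans (sym (m+[n∸m]≡n (≤-trans (s≤s z≤n) 2c+3≤L))) (cong suc L∸1≡)
      open Pairs m e L≡
      c<m : c < m
      c<m = ≰⇒> λ m≤c → 1+n≰n (begin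
        suc (suc (suc (c + c)))   ≤⟨ 2c+3≤L ⟩
        L                         ≡⟨ L≡ ⟩
        suc (m + e + m)           ≤⟨ s≤s (+-mono-≤ (+-mono-≤ m≤c e≤1) m≤c) ⟩
        suc (c + 1 + c)           ≡⟨ cong suc (arith c) ⟩
        suc (suc (c + c))         ∎)
        where
        open ≤-Reasoning
        arith : ∀ c → c + 1 + c ≡ suc (c + c)
        arith = solve-∀
      too-small : (c + 2) * (c + 3) < 2 * L + (m * suc m + 2 * (∑< m excess + middle))
      too-small = begin-strict
        (c + 2) * (c + 3)                          <⟨ arith c ⟩
        2 * suc (suc (suc (c + c))) + suc c * suc (suc c) ≤⟨ +-mono-≤ (*-monoʳ-≤ 2 2c+3≤L) (*-mono-≤ c<m (s≤s c<m)) ⟩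
        2 * L + m * suc m                          ≤⟨ +-monoʳ-≤ (2 * L) (m≤m+n _ _) ⟩
        2 * L + (m * suc m + 2 * (∑< m excess + middle)) ∎
        where
        open ≤-Reasoning
        arith : ∀ c → (c + 2) * (c + 3) < 2 * suc (suc (suc (c + c))) + suc c * suc (suc c)
        arith c = ≤-trans (m≤m+n _ (c + c + 1)) (≤-reflexive (expand c))
          where
          expand : ∀ c → suc ((c + 2) * (c + 3)) + (c + c + 1) ≡ 2 * suc (suc (suc (c + c))) + suc c * suc (suc c)
          expand = solve-∀

  largest≤2c : ∀ c → 2 ≤ c → 2 * sum ps ≡ (c + 2) * (c + 3) → L ≤ c + c
  largest≤2c c 2≤c 2sum≡ with L ≤? c + c
  ... | yes L≤2c = L≤2c
  ... | no L≰2c with m≤n⇒m<n∨m≡n (≰⇒> L≰2c)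
  ...   | inj₂ 2c+1≡L = ⊥-elim (2c+1-excluded c 2≤c (sym 2c+1≡L) 2sum≡)
  ...   | inj₁ 2c+1<L with m≤n⇒m<n∨m≡n 2c+1<L
  ...     | inj₂ 2c+2≡L = ⊥-elim (2c+2-excluded c (≤-trans (s≤s z≤n) 2≤c) (sym 2c+2≡L) 2sum≡)
  ...     | inj₁ 2c+2<L = ⊥-elim (2c+3≤-excluded c 2c+2<L 2sum≡)

-- Partitions with largest part 2c and c missing parts

record Complementary (c : ℕ) (ps : List ℕ) : Set where
  field
    increasing : Linked _<_ ps
    ≤2c        : All (_≤ c + c) ps
    2c∈        : c + c ∈ ps
    c∉         : c ∉ ps
    reflect    : ∀ {x} → x ≤ c + c → x ≢ c → x ∈ ps ⇔ c + c ∸ x ∉ ps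
    #parts     : length ps ≡ c

module _ {ps : List ℕ} (c′ : ℕ) (increasing : Linked _<_ ps) (positive : All (1 ≤_) ps)
         (unrefinable : Unrefinable ps) (L≡2c : largest ps ≡ suc c′ + suc c′) (#M≡c : numMissing ps ≡ suc c′) where

  private
    c = suc c′
    d = c + c

    2c∈ : d ∈ ps
    2c∈ = subst (_∈ ps) L≡2c (largest∈ ps (subst (1 ≤_) (sym L≡2c) (s≤s z≤n)))

    0∉ : 0 ∉ ps
    0∉ 0∈ with All.lookup positive 0∈
    ... | ()

    μ0≡1 : μ ps 0 ≡ 1
    μ0≡1 = 𝟙-yes (¬? (0 ∈? ps)) 0∉

    μd≡0 : μ ps d ≡ 0
    μd≡0 = 𝟙-no (¬? (d ∈? ps)) (λ d∉ → d∉ 2c∈)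

    #M≡∑ : numMissing ps ≡ ∑[ x < d ] μ ps (suc x)
    #M≡∑ = begin
      numMissing ps                                         ≡⟨ length-filter≡sum-map (λ m → ¬? (m ∈? ps)) (map suc (upTo L)) ⟩
      sum (map (μ ps) (map suc (upTo L)))                   ≡⟨ cong (sum ∘ map (μ ps)) (map-applyUpTo suc (λ x → x) L) ⟩
      sum (map (μ ps) (applyUpTo suc L))                    ≡⟨ cong sum (map-applyUpTo (μ ps) suc L) ⟩
      sum (applyUpTo (μ ps ∘ suc) L)                        ≡⟨ sum-applyUpTo (μ ps ∘ suc) L ⟩
      ∑[ x < L ] μ ps (suc x)                               ≡⟨ cong (λ k → ∑[ x < k ] μ ps (suc x)) L≡2c ⟩
      ∑[ x < d ] μ ps (suc x)                               ∎
      where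
      open ≡-Reasoning
      L = largest ps

    ∑μ≡1+c : ∑< (suc d) (μ ps) ≡ suc c
    ∑μ≡1+c = trans (∑-suc d (μ ps)) (cong₂ _+_ μ0≡1 (trans (sym #M≡∑) #M≡c))

    d≡ : suc (c′ + 1 + c′) ≡ d
    d≡ = cong suc (trans (+-comm (c′ + 1) c′) (cong (c′ +_) (+-comm c′ 1)))

    partner : ∀ a → c′ + 1 + c′ ∸ a ≡ d ∸ suc a
    partner a = cong (λ k → k ∸ suc a) d≡

    pair : ℕ → ℕ
    pair a = μ ps (suc a) + μ ps (d ∸ suc a)

    pairs+μc≡c : ∑< c′ pair + μ ps c ≡ c
    pairs+μc≡c = suc-injective (begin
      suc (∑< c′ pair + μ ps c)
        ≡⟨ cong₂ (λ p m → suc (p + m)) pairs≡ (cong (μ ps) (sym (+-identityʳ c))) ⟩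
      1 + rest                                                    ≡⟨ cong (_+ rest) (sym μ0≡1) ⟩
      μ ps 0 + rest                                               ≡⟨ sym (∑-pairUp c′ 1 (μ ps)) ⟩
      ∑< (suc (c′ + 1 + c′)) (μ ps)                               ≡⟨ cong (λ k → ∑< k (μ ps)) d≡ ⟩
      ∑< d (μ ps)                                                 ≡⟨ sym (trans (cong (∑< d (μ ps) +_) μd≡0) (+-identityʳ _)) ⟩
      ∑< (suc d) (μ ps)                                           ≡⟨ ∑μ≡1+c ⟩
      suc c                                                       ∎)
      where
      open ≡-Reasoning
      rest = ∑[ a < c′ ] (μ ps (suc a) + μ ps (c′ + 1 + c′ ∸ a)) + ∑[ a < 1 ] μ ps (c + a)
      pairs≡ : ∑< c′ pair ≡ ∑[ a < c′ ] (μ ps (suc a) + μ ps (c′ + 1 + c′ ∸ a))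
      pairs≡ = ∑-cong c′ (λ a _ → cong (λ y → μ ps (suc a) + μ ps y) (sym (partner a)))

    pair≤1 : ∀ a → a < c′ → pair a ≤ 1
    pair≤1 a a<c′ with suc a ∈? ps | (d ∸ suc a) ∈? ps
    ... | yes _ | yes _ = z≤n
    ... | yes _ | no _  = ≤-refl
    ... | no _  | yes _ = ≤-refl
    ... | no x∉ | no y∉ = ⊥-elim (summands-of-largest-not-both-missing unrefinable (subst (_∈ ps) (sym L≡2c) 2c∈)
                            (s≤s z≤n) x<y (trans (m+[n∸m]≡n x≤d) (sym L≡2c)) x∉ y∉)
      where
      x<c : suc a < c
      x<c = s≤s a<c′
      x≤d : suc a ≤ d
      x≤d = ≤-trans (<⇒≤ x<c) (m≤m+n c c)
      x<y : suc a < d ∸ suc a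
      x<y = <-≤-trans x<c (subst (_≤ d ∸ suc a) (m+n∸n≡m c c) (∸-monoʳ-≤ d (<⇒≤ x<c)))

    1≤μc : 1 ≤ μ ps c
    1≤μc = +-cancelˡ-≤ c′ 1 (μ ps c) (begin
      c′ + 1                 ≡⟨ +-comm c′ 1 ⟩
      c                      ≡⟨ sym pairs+μc≡c ⟩
      ∑< c′ pair + μ ps c    ≤⟨ +-monoˡ-≤ (μ ps c) (∑≤1⇒≤n c′ pair pair≤1) ⟩
      c′ + μ ps c            ∎)
      where open ≤-Reasoning

    μc≡1 : μ ps c ≡ 1
    μc≡1 = ≤-antisym (𝟙≤1 (¬? (c ∈? ps))) 1≤μc

    pair≡1 : ∀ a → a < c′ → pair a ≡ 1
    pair≡1 = ∑≤1-≡n⇒≡1 c′ pair pair≤1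
      (+-cancelʳ-≡ 1 _ _ (trans (cong (∑< c′ pair +_) (sym μc≡1)) (trans pairs+μc≡c (+-comm 1 c′))))

    reflect-below : ∀ x → x < c → μ ps x + μ ps (d ∸ x) ≡ 1
    reflect-below zero    _          = cong₂ _+_ μ0≡1 μd≡0
    reflect-below (suc a) (s≤s a<c′) = pair≡1 a a<c′

    reflect-μ : ∀ {x} → x ≤ d → x ≢ c → μ ps x + μ ps (d ∸ x) ≡ 1
    reflect-μ {x} x≤d x≢c with <-cmp x c
    ... | tri< x<c _ _ = reflect-below x x<c
    ... | tri≈ _ x≡c _ = ⊥-elim (x≢c x≡c)
    ... | tri> _ _ c<x = trans (+-comm (μ ps x) _)
          (subst (λ y → μ ps (d ∸ x) + μ ps y ≡ 1) (m∸[m∸n]≡n x≤d)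
                 (reflect-below (d ∸ x) (subst (d ∸ x <_) (m+n∸n≡m c c) (∸-monoʳ-< c<x x≤d))))

    ≤2c : All (_≤ d) ps
    ≤2c = subst (λ L → All (_≤ L) ps) L≡2c (≤-largest ps)

    #parts≡c : length ps ≡ c
    #parts≡c = +-cancelʳ-≡ (suc c) _ _ (begin
      length ps + suc c                          ≡⟨ cong₂ _+_ #parts≡∑χ (sym ∑μ≡1+c) ⟩
      ∑< (suc d) (χ ps) + ∑< (suc d) (μ ps)       ≡⟨ sym (∑-distrib-+ (suc d)) ⟩
      ∑[ x < suc d ] (χ ps x + μ ps x)           ≡⟨ ∑-cong (suc d) (λ x _ → χ+μ≡1 ps x) ⟩
      ∑[ _ < suc d ] 1                           ≡⟨ ∑-const-1 (suc d) ⟩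
      suc (c + c)                                ≡⟨ sym (+-suc c c) ⟩
      c + suc c                                  ∎)
      where
      open ≡-Reasoning
      #parts≡∑χ : length ps ≡ ∑< (suc d) (χ ps)
      #parts≡∑χ = length≡∑χ (suc d) (increasing⇒unique increasing) (All.map s≤s ≤2c)

  largest-2c⇒complementary : Complementary c ps
  largest-2c⇒complementary = record
    { increasing = increasing
    ; ≤2c        = ≤2c
    ; 2c∈        = 2c∈
    ; c∉         = λ c∈ → 0≢1+n (trans (sym (𝟙-no (¬? (c ∈? ps)) (λ c∉ → c∉ c∈))) μc≡1)
    ; reflect    = λ x≤d x≢c → exactly-one (reflect-μ x≤d x≢c)
    ; #parts     = #parts≡c
    }

-- The Young diagram of a complementary partition

module Diagram {c : ℕ} {ps : List ℕ} (cps : Complementary c ps) where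

  open Complementary cps

  private
    d = c + c
    B = suc d

    1≤c : 1 ≤ c
    1≤c = n≢0⇒n>0 (λ c≡0 → c∉ (subst (_∈ ps) (sym c≡0) (subst (λ k → k + k ∈ ps) c≡0 2c∈)))

    0∉ : 0 ∉ ps
    0∉ 0∈ = to (reflect z≤n (λ 0≡c → <⇒≢ 1≤c 0≡c)) 0∈ 2c∈

    ps<B : All (_< B) ps
    ps<B = All.map s≤s ≤2c

  count : {P : ℕ → Set} → Decidable P → ℕ
  count P? = ∑[ y < B ] (χ ps y * 𝟙 (P? y))

  count-mono : {P Q : ℕ → Set} (P? : Decidable P) (Q? : Decidable Q) →
               (∀ {y} → y ∈ ps → P y → Q y) → count P? ≤ count Q?
  count-mono P? Q? P⇒Q = ∑-mono-≤ B term
    where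
    term : ∀ y → y < B → χ ps y * 𝟙 (P? y) ≤ χ ps y * 𝟙 (Q? y)
    term y _ with y ∈? ps
    ... | yes y∈ = *-monoʳ-≤ 1 (𝟙-mono (P? y) (Q? y) (P⇒Q y∈))
    ... | no _   = z≤n

  count-cong : {P Q : ℕ → Set} (P? : Decidable P) (Q? : Decidable Q) →
               (∀ {y} → y ∈ ps → P y → Q y) → (∀ {y} → y ∈ ps → Q y → P y) → count P? ≡ count Q?
  count-cong P? Q? P⇒Q Q⇒P = ≤-antisym (count-mono P? Q? P⇒Q) (count-mono Q? P? Q⇒P)

  count-witness : {P : ℕ → Set} (P? : Decidable P) → ∀ {y} → y ∈ ps → P y → 1 ≤ count P?
  count-witness P? {y} y∈ Py = ≤-trans (≤-reflexive (sym term≡1)) (term≤∑ B _ (All.lookup ps<B y∈))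
    where
    term≡1 : χ ps y * 𝟙 (P? y) ≡ 1
    term≡1 = cong₂ _*_ (𝟙-yes (y ∈? ps) y∈) (𝟙-yes (P? y) Py)

  private
    ∑χ≡c : ∑< B (χ ps) ≡ c
    ∑χ≡c = trans (sym (length≡∑χ B (increasing⇒unique increasing) ps<B)) #parts

  count≤c : {P : ℕ → Set} (P? : Decidable P) → count P? ≤ c
  count≤c P? = subst (count P? ≤_) ∑χ≡c
    (∑-mono-≤ B (λ y _ → ≤-trans (*-monoʳ-≤ (χ ps y) (𝟙≤1 (P? y))) (≤-reflexive (*-identityʳ (χ ps y)))))

  count-all : {P : ℕ → Set} (P? : Decidable P) → (∀ {y} → y ∈ ps → P y) → count P? ≡ c
  count-all P? all = trans (∑-cong B (λ y _ → term y)) ∑χ≡c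
    where
    term : ∀ y → χ ps y * 𝟙 (P? y) ≡ χ ps y
    term y with y ∈? ps
    ... | yes y∈ = cong (1 *_) (𝟙-yes (P? y) (all y∈))
    ... | no _   = refl

  length-filter≡count : {P : ℕ → Set} (P? : Decidable P) → length (filter P? ps) ≡ count P?
  length-filter≡count P? = trans (length-filter≡sum-map P? ps)
    (sum-map≡∑ B (increasing⇒unique increasing) ps<B (𝟙 ∘ P?))

  reach : ℕ → ℕ
  reach g = count (λ y → d <? y + g)

  gapsBelow≡∑μ : ∀ g → gapsBelow ps g ≡ ∑< g (μ ps)
  gapsBelow≡∑μ g = begin
    gapsBelow ps g               ≡⟨ length-filter≡sum-map (λ s → ¬? (s ∈? ps)) (upTo g) ⟩
    sum (map (μ ps) (upTo g))    ≡⟨ cong sum (map-applyUpTo (μ ps) (λ x → x) g) ⟩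
    sum (applyUpTo (μ ps) g)     ≡⟨ sum-applyUpTo (μ ps) g ⟩
    ∑< g (μ ps)                  ∎
    where open ≡-Reasoning

  private
    d∸x<g⇔d<x+g : ∀ {x g} → x ≤ d → d ∸ x < g ⇔ d < x + g
    d∸x<g⇔d<x+g {x} {g} x≤d = mk⇔
      (λ d∸x<g → subst (_< x + g) (m+[n∸m]≡n x≤d) (+-monoʳ-< x d∸x<g))
      (λ d<x+g → +-cancelˡ-< x (d ∸ x) g (subst (_< x + g) (sym (m+[n∸m]≡n x≤d)) d<x+g))

  -- Reflecting s ↦ 2c ∸ s turns the gaps s < g other than c into the parts y with y + g > 2c.
  gapsBelow≡reach+[c<g] : ∀ {g} → g ≤ d → gapsBelow ps g ≡ reach g + 𝟙 (c <? g)
  gapsBelow≡reach+[c<g] {g} g≤d = begin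
    gapsBelow ps g                                                   ≡⟨ gapsBelow≡∑μ g ⟩
    ∑< g (μ ps)                                                      ≡⟨ ∑-restrict (μ ps) (m≤n⇒m≤1+n g≤d) ⟩
    ∑[ s < B ] (μ ps s * 𝟙 (s <? g))                                 ≡⟨ ∑-reverse B (λ s → μ ps s * 𝟙 (s <? g)) ⟩
    ∑[ x < B ] (μ ps (d ∸ x) * 𝟙 (d ∸ x <? g))                       ≡⟨ ∑-cong B reflected ⟩
    ∑[ x < B ] (χ ps x * 𝟙 (d <? x + g) + 𝟙 (x ≟ c) * 𝟙 (c <? g))    ≡⟨ ∑-distrib-+ B ⟩
    reach g + ∑[ x < B ] (𝟙 (x ≟ c) * 𝟙 (c <? g))
      ≡⟨ cong (reach g +_) (∑-select B (λ _ → 𝟙 (c <? g)) (s≤s (m≤m+n c c))) ⟩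
    reach g + 𝟙 (c <? g)                                             ∎
    where
    open ≡-Reasoning
    reflected : ∀ x → x < B → μ ps (d ∸ x) * 𝟙 (d ∸ x <? g) ≡ χ ps x * 𝟙 (d <? x + g) + 𝟙 (x ≟ c) * 𝟙 (c <? g)
    reflected x (s≤s x≤d) with x ≟ c
    ... | yes refl = begin
      μ ps (d ∸ c) * 𝟙 (d ∸ c <? g)                   ≡⟨ cong (λ k → μ ps k * 𝟙 (k <? g)) (m+n∸n≡m c c) ⟩
      μ ps c * 𝟙 (c <? g)                             ≡⟨ cong (_* 𝟙 (c <? g)) (𝟙-yes (¬? (c ∈? ps)) c∉) ⟩
      1 * 𝟙 (c <? g)                                  ≡⟨ cong (λ k → k * 𝟙 (d <? c + g) + 1 * 𝟙 (c <? g)) (𝟙-no (c ∈? ps) c∉) ⟨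
      χ ps c * 𝟙 (d <? c + g) + 1 * 𝟙 (c <? g)        ∎
    ... | no x≢c = trans (cong₂ _*_ μ≡χ (𝟙-cong (d ∸ x <? g) (d <? x + g) (to d∸x<g⇔) (from d∸x<g⇔)))
                         (sym (+-identityʳ _))
      where
      d∸x<g⇔ = d∸x<g⇔d<x+g {x} {g} x≤d
      μ≡χ : μ ps (d ∸ x) ≡ χ ps x
      μ≡χ = 𝟙-cong (¬? ((d ∸ x) ∈? ps)) (x ∈? ps) (from (reflect x≤d x≢c)) (to (reflect x≤d x≢c))

  count-≥≡1+count-> : ∀ {g} → g ∈ ps → count (g ≤?_) ≡ suc (count (g <?_))
  count-≥≡1+count-> {g} g∈ = begin
    count (g ≤?_)                                                 ≡⟨ ∑-cong B (λ y _ → split y) ⟩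
    ∑[ y < B ] (χ ps y * 𝟙 (g <? y) + 𝟙 (y ≟ g) * 1)              ≡⟨ ∑-distrib-+ B ⟩
    count (g <?_) + ∑[ y < B ] (𝟙 (y ≟ g) * 1)
      ≡⟨ cong (count (g <?_) +_) (∑-select B (λ _ → 1) (All.lookup ps<B g∈)) ⟩
    count (g <?_) + 1                                             ≡⟨ +-comm _ 1 ⟩
    suc (count (g <?_))                                           ∎
    where
    open ≡-Reasoning
    split : ∀ y → χ ps y * 𝟙 (g ≤? y) ≡ χ ps y * 𝟙 (g <? y) + 𝟙 (y ≟ g) * 1
    split y with y ≟ g
    ... | yes refl = begin
      χ ps g * 𝟙 (g ≤? g)       ≡⟨ cong₂ _*_ (𝟙-yes (g ∈? ps) g∈) (𝟙-yes (g ≤? g) ≤-refl) ⟩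
      1                         ≡⟨ cong (_+ 1) (trans (cong (χ ps g *_) (𝟙-no (g <? g) (<-irrefl refl))) (*-zeroʳ (χ ps g))) ⟨
      χ ps g * 𝟙 (g <? g) + 1   ∎
    ... | no y≢g = trans (cong (χ ps y *_) (𝟙-cong (g ≤? y) (g <? y) (λ g≤y → ≤∧≢⇒< g≤y (y≢g ∘ sym)) <⇒≤))
                         (sym (+-identityʳ _))

  part : ℕ → ℕ
  part i = at (reverse ps) i

  module _ {i} (1≤i : 1 ≤ i) (i≤c : i ≤ c) where

    private
      i≤#ps = subst (i ≤_) (sym #parts) i≤c

    part∈ : part i ∈ ps
    part∈ = proj₁ (ith-largest increasing 1≤i i≤#ps)

    count-≥part : count (part i ≤?_) ≡ i
    count-≥part = trans (sym (length-filter≡count (part i ≤?_))) (proj₂ (ith-largest increasing 1≤i i≤#ps))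

    1+count->part : suc (count (part i <?_)) ≡ i
    1+count->part = trans (sym (count-≥≡1+count-> part∈)) count-≥part

  count-≥≤reach : ∀ {g x} → d < x + g → count (g ≤?_) ≤ reach x
  count-≥≤reach {g} {x} d<x+g = count-mono (g ≤?_) (λ y → d <? y + x)
    (λ {y} _ g≤y → <-≤-trans d<x+g (subst (x + g ≤_) (+-comm x y) (+-monoʳ-≤ x g≤y)))

  reach≤count-> : ∀ {g x} → x + g ≤ d → reach x ≤ count (g <?_)
  reach≤count-> {g} {x} x+g≤d = count-mono (λ y → d <? y + x) (g <?_)
    (λ {y} _ d<y+x → ≰⇒> (λ y≤g → <⇒≱ d<y+x (≤-trans (subst (_≤ x + g) (+-comm x y) (+-monoʳ-≤ x y≤g)) x+g≤d)))

  #large : ℕ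
  #large = count (c <?_)

  private
    #large≤c : #large ≤ c
    #large≤c = count≤c (c <?_)

  part>c : ∀ {i} → 1 ≤ i → i ≤ #large → c < part i
  part>c {i} 1≤i i≤#large with c <? part i
  ... | yes c<g = c<g
  ... | no c≮g = ⊥-elim (1+n≰n (subst (_≤ count (part i <?_)) (sym (1+count->part 1≤i i≤c)) i≤count->))
    where
    i≤c = ≤-trans i≤#large #large≤c
    i≤count-> : i ≤ count (part i <?_)
    i≤count-> = ≤-trans i≤#large (count-mono (c <?_) (part i <?_) (λ _ c<y → ≤-<-trans (≮⇒≥ c≮g) c<y))

  part<c : ∀ {i} → #large < i → i ≤ c → part i < c
  part<c {i} #large<i i≤c with part i <? c
  ... | yes g<c = g<c
  ... | no g≮c = ⊥-elim (<⇒≱ #large<i (subst (_≤ #large) (count-≥part 1≤i i≤c)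
                   (count-mono (part i ≤?_) (c <?_) (λ _ g≤y → <-≤-trans c<g g≤y))))
    where
    1≤i = ≤-trans (s≤s z≤n) #large<i
    c<g : c < part i
    c<g = ≤∧≢⇒< (≮⇒≥ g≮c) (λ c≡g → c∉ (subst (_∈ ps) (sym c≡g) (part∈ 1≤i i≤c)))

  row≡gapsBelow-part : ∀ i → R ps i ≡ gapsBelow ps (part i)
  row≡gapsBelow-part = at-map (gapsBelow ps) refl (reverse ps)

  column≡count : ∀ j → C ps j ≡ count (λ x → j ≤? gapsBelow ps x)
  column≡count j = begin
    C ps j                                                        ≡⟨ length-filter≡sum-map (j ≤?_) (map (gapsBelow ps) (reverse ps)) ⟩
    sum (map (𝟙 ∘ (j ≤?_)) (map (gapsBelow ps) (reverse ps)))     ≡⟨ cong sum (map-∘ (reverse ps)) ⟨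
    sum (map (λ x → 𝟙 (j ≤? gapsBelow ps x)) (reverse ps))        ≡⟨ sum-map-reverse (λ x → 𝟙 (j ≤? gapsBelow ps x)) ps ⟩
    sum (map (λ x → 𝟙 (j ≤? gapsBelow ps x)) ps)                  ≡⟨ sum-map≡∑ B (increasing⇒unique increasing) ps<B _ ⟩
    count (λ x → j ≤? gapsBelow ps x)                             ∎
    where open ≡-Reasoning

  gapsBelow-≤c : ∀ {x} → x ≤ c → gapsBelow ps x ≡ reach x
  gapsBelow-≤c {x} x≤c = trans (gapsBelow≡reach+[c<g] (≤-trans x≤c (m≤m+n c c)))
    (trans (cong (reach x +_) (𝟙-no (c <? x) (≤⇒≯ x≤c))) (+-identityʳ (reach x)))

  gapsBelow->c : ∀ {x} → c < x → x ≤ d → gapsBelow ps x ≡ reach x + 1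
  gapsBelow->c {x} c<x x≤d = trans (gapsBelow≡reach+[c<g] x≤d) (cong (reach x +_) (𝟙-yes (c <? x) c<x))

  gapsBelow≤reach+1 : ∀ {x} → x ≤ d → gapsBelow ps x ≤ reach x + 1
  gapsBelow≤reach+1 {x} x≤d = subst (_≤ reach x + 1) (sym (gapsBelow≡reach+[c<g] x≤d)) (+-monoʳ-≤ (reach x) (𝟙≤1 (c <? x)))

  column-upper : ∀ {i} → 1 ≤ i → i ≤ #large → C ps i ≡ reach (part i)
  column-upper {i} 1≤i i≤#large = trans (column≡count i) (count-cong _ _ far far⁻¹)
    where
    g = part i
    i≤c = ≤-trans i≤#large #large≤c
    far : ∀ {x} → x ∈ ps → i ≤ gapsBelow ps x → d < x + g
    far {x} _ i≤gaps = ≰⇒> λ x+g≤d →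
      let x<c = +-cancelʳ-< c x c (<-≤-trans (+-monoʳ-< x (part>c 1≤i i≤#large)) x+g≤d)
      in 1+n≰n (begin
        suc (count (g <?_))   ≡⟨ 1+count->part 1≤i i≤c ⟩
        i                     ≤⟨ i≤gaps ⟩
        gapsBelow ps x        ≡⟨ gapsBelow-≤c (<⇒≤ x<c) ⟩
        reach x               ≤⟨ reach≤count-> x+g≤d ⟩
        count (g <?_)         ∎)
      where open ≤-Reasoning
    far⁻¹ : ∀ {x} → x ∈ ps → d < x + g → i ≤ gapsBelow ps x
    far⁻¹ {x} x∈ d<x+g = begin
      i                       ≡⟨ count-≥part 1≤i i≤c ⟨
      count (g ≤?_)           ≤⟨ count-≥≤reach d<x+g ⟩
      reach x                 ≤⟨ m≤m+n (reach x) _ ⟩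
      reach x + 𝟙 (c <? x)    ≡⟨ gapsBelow≡reach+[c<g] (All.lookup ≤2c x∈) ⟨
      gapsBelow ps x          ∎
      where open ≤-Reasoning

  column-lower : ∀ {i} → #large < i → i ≤ c → C ps (i + 1) ≡ reach (part i)
  column-lower {i} #large<i i≤c = trans (column≡count (i + 1)) (count-cong _ _ far far⁻¹)
    where
    g = part i
    1≤i = ≤-trans (s≤s z≤n) #large<i
    far : ∀ {x} → x ∈ ps → i + 1 ≤ gapsBelow ps x → d < x + g
    far {x} x∈ i+1≤gaps = ≰⇒> λ x+g≤d → 1+n≰n (begin
      suc i                   ≡⟨ +-comm 1 i ⟩
      i + 1                   ≤⟨ i+1≤gaps ⟩
      gapsBelow ps x          ≤⟨ gapsBelow≤reach+1 (All.lookup ≤2c x∈) ⟩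
      reach x + 1             ≤⟨ +-monoˡ-≤ 1 (reach≤count-> x+g≤d) ⟩
      count (g <?_) + 1       ≡⟨ +-comm _ 1 ⟩
      suc (count (g <?_))     ≡⟨ 1+count->part 1≤i i≤c ⟩
      i                       ∎)
      where open ≤-Reasoning
    far⁻¹ : ∀ {x} → x ∈ ps → d < x + g → i + 1 ≤ gapsBelow ps x
    far⁻¹ {x} x∈ d<x+g = begin
      i + 1                   ≡⟨ cong (_+ 1) (count-≥part 1≤i i≤c) ⟨
      count (g ≤?_) + 1       ≤⟨ +-monoˡ-≤ 1 (count-≥≤reach d<x+g) ⟩
      reach x + 1             ≡⟨ gapsBelow->c c<x (All.lookup ≤2c x∈) ⟨
      gapsBelow ps x          ∎
      where
      open ≤-Reasoning
      c<x : c < x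
      c<x = ≰⇒> λ x≤c → <⇒≱ d<x+g (<⇒≤ (+-mono-≤-< x≤c (part<c #large<i i≤c)))

  rows-upper : ∀ {i} → 1 ≤ i → i ≤ #large → R ps i ≡ C ps i + 1
  rows-upper {i} 1≤i i≤#large = begin
    R ps i                   ≡⟨ row≡gapsBelow-part i ⟩
    gapsBelow ps (part i)    ≡⟨ gapsBelow->c (part>c 1≤i i≤#large) (All.lookup ≤2c (part∈ 1≤i (≤-trans i≤#large #large≤c))) ⟩
    reach (part i) + 1       ≡⟨ cong (_+ 1) (column-upper 1≤i i≤#large) ⟨
    C ps i + 1               ∎
    where open ≡-Reasoning

  rows-lower : ∀ {i} → #large < i → i ≤ c → R ps i ≡ C ps (i + 1)
  rows-lower {i} #large<i i≤c = begin
    R ps i                   ≡⟨ row≡gapsBelow-part i ⟩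
    gapsBelow ps (part i)    ≡⟨ gapsBelow-≤c (<⇒≤ (part<c #large<i i≤c)) ⟩
    reach (part i)           ≡⟨ column-lower #large<i i≤c ⟨
    C ps (i + 1)             ∎
    where open ≡-Reasoning

  part-1≡2c : part 1 ≡ d
  part-1≡2c = ≤-antisym (All.lookup ≤2c (part∈ ≤-refl 1≤c)) (≮⇒≥ λ part-1<d →
    1+n≰n (subst (2 ≤_) (1+count->part ≤-refl 1≤c) (s≤s (count-witness (part 1 <?_) 2c∈ part-1<d))))

  reach-2c : reach d ≡ c
  reach-2c = count-all (λ y → d <? y + d) (λ y∈ → +-monoˡ-≤ d (n≢0⇒n>0 (λ y≡0 → 0∉ (subst (_∈ ps) y≡0 y∈))))

  gapsBelow-2c : gapsBelow ps d ≡ suc c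
  gapsBelow-2c = trans (gapsBelow->c (m<m+n c 1≤c) ≤-refl) (trans (cong (_+ 1) reach-2c) (+-comm c 1))

  row-1 : R ps 1 ≡ suc c
  row-1 = trans (row≡gapsBelow-part 1) (trans (cong (gapsBelow ps) part-1≡2c) gapsBelow-2c)

  column-positive : ∀ {j} → j ≤ suc c → 1 ≤ C ps j
  column-positive {j} j≤1+c = subst (1 ≤_) (sym (column≡count j))
    (count-witness (λ x → j ≤? gapsBelow ps x) 2c∈ (subst (j ≤_) (sym gapsBelow-2c) j≤1+c))

  column≡z⇒z≡#large : ∀ {z} → z ≤ c → C ps (z + 1) ≡ z → z ≡ #large
  column≡z⇒z≡#large {z} z≤c C≡z with <-cmp z #large
  ... | tri≈ _ z≡#large _ = z≡#large
  ... | tri< z<#large _ _ = ⊥-elim (1+n≰n (begin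
    suc z                    ≡⟨ +-comm 1 z ⟩
    z + 1                    ≡⟨ count-≥part 1≤z+1 z+1≤c ⟨
    count (g ≤?_)            ≤⟨ count-≥≤reach (+-mono-< c<g c<g) ⟩
    reach g                  ≡⟨ column-upper 1≤z+1 z+1≤#large ⟨
    C ps (z + 1)             ≡⟨ C≡z ⟩
    z                        ∎))
    where
    open ≤-Reasoning
    1≤z+1 = subst (1 ≤_) (+-comm 1 z) (s≤s z≤n)
    z+1≤#large = subst (_≤ #large) (+-comm 1 z) z<#large
    z+1≤c = ≤-trans z+1≤#large #large≤c
    g = part (z + 1)
    c<g = part>c 1≤z+1 z+1≤#large
  ... | tri> _ _ #large<z = ⊥-elim (<⇒≱ #large<z (begin
    z                        ≡⟨ C≡z ⟨
    C ps (z + 1)             ≡⟨ column-lower #large<z z≤c ⟩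
    reach (part z)           ≤⟨ count-mono _ (c <?_) (λ _ → large) ⟩
    #large                   ∎))
    where
    open ≤-Reasoning
    large : ∀ {y} → d < y + part z → c < y
    large d<y+g = ≰⇒> λ y≤c → <⇒≱ d<y+g (<⇒≤ (+-mono-≤-< y≤c (part<c #large<z z≤c)))

  hook⇒z≡#large : ∀ z → InDiagram ps 1 (z + 1) → hook ps 1 (z + 1) ≡ c → z ≡ #large
  hook⇒z≡#large z (_ , _ , z+1≤R₁) hook≡c =
    column≡z⇒z≡#large z≤c (arm+leg (column-positive z+1≤1+c) hook≡c′)
    where
    hook≡c′ : (suc c ∸ (z + 1)) + (C ps (z + 1) ∸ 1) + 1 ≡ c
    hook≡c′ = subst (λ r → (r ∸ (z + 1)) + (C ps (z + 1) ∸ 1) + 1 ≡ c) row-1 hook≡c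
    z+1≤1+c = subst (z + 1 ≤_) row-1 z+1≤R₁
    z≤c : z ≤ c
    z≤c = ≤-pred (subst (_≤ suc c) (+-comm z 1) z+1≤1+c)
    arm+leg : ∀ {a} → 1 ≤ a → (suc c ∸ (z + 1)) + (a ∸ 1) + 1 ≡ c → a ≡ z
    arm+leg {suc a} _ eq = trans (+-comm 1 a) (+-cancelˡ-≡ (c ∸ z) (a + 1) z (begin
      c ∸ z + (a + 1)             ≡⟨ +-assoc (c ∸ z) a 1 ⟨
      c ∸ z + a + 1               ≡⟨ cong (λ k → suc c ∸ k + a + 1) (+-comm 1 z) ⟩
      suc c ∸ (z + 1) + a + 1     ≡⟨ eq ⟩
      c                           ≡⟨ m∸n+n≡m z≤c ⟨
      c ∸ z + z                   ∎))
      where open ≡-Reasoning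

Ū-rows-columns : ∀ c → 4 ≤ c → ∀ {lam} → InUbar (T (c + 2)) lam →
  ∀ z → InDiagram lam 1 (z + 1) → hook lam 1 (z + 1) ≡ c →
  ((i : ℕ) → 1 ≤ i → i ≤ z → R lam i ≡ C lam i + 1) ×
  ((i : ℕ) → z + 1 ≤ i → i ≤ c → R lam i ≡ C lam (i + 1))
Ū-rows-columns c@(suc c′) 4≤c {lam} ((((increasing , positive , _) , unrefinable , sum≡) , maximal) , #M≡) z z∈Y hook≡c =
  (λ i 1≤i i≤z → rows-upper 1≤i (subst (i ≤_) z≡#large i≤z)) ,
  (λ i z+1≤i i≤c → rows-lower (subst (_≤ i) (trans (+-comm z 1) (cong suc z≡#large)) z+1≤i) i≤c)
  where
  2*T≡ : 2 * T (c + 2) ≡ (c + 2) * (c + 3)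
  2*T≡ = trans (2*T≡n*[1+n] (c + 2)) (cong ((c + 2) *_) (sym (+-suc c 2)))
  2*sum≡ : 2 * sum lam ≡ (c + 2) * (c + 3)
  2*sum≡ = trans (cong (2 *_) sum≡) 2*T≡
  2c≤L : c + c ≤ largest lam
  2c≤L with W , W-unref , L[W]≡2c ← unrefinable-with-largest-2c c′ 4≤c 2*T≡
    = subst (_≤ largest lam) L[W]≡2c (maximal W W-unref)
  L≡2c : largest lam ≡ c + c
  L≡2c = ≤-antisym (largest≤2c c (≤-trans (s≤s (s≤s z≤n)) 4≤c) 2*sum≡) 2c≤L
    where open LargestPartBound increasing unrefinable (largest∈ lam (≤-trans (s≤s z≤n) 2c≤L))
  #M≡c : numMissing lam ≡ c
  #M≡c = trans #M≡ (trans (cong (_/ 2) (trans L≡2c 2c≡c*2)) (m*n/n≡m c 2))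
    where
    2c≡c*2 : c + c ≡ c * 2
    2c≡c*2 = trans (cong (c +_) (sym (+-identityʳ c))) (*-comm 2 c)
  open Diagram (largest-2c⇒complementary c′ increasing positive unrefinable L≡2c #M≡c)
  z≡#large : z ≡ #large
  z≡#large = hook⇒z≡#large z z∈Y hook≡c

lemma3p6 : (k : ℕ) → 4 ≤ k → (lam : List ℕ) → InUbar (T (2 * k ∸ 1)) lam →
    (z : ℕ) → InDiagram lam 1 (z + 1) → hook lam 1 (z + 1) ≡ (2 * k ∸ 1) ∸ 2 →
    ((i : ℕ) → 1 ≤ i → i ≤ z → R lam i ≡ C lam i + 1) ×
    ((i : ℕ) → z + 1 ≤ i → i ≤ (2 * k ∸ 1) ∸ 2 → R lam i ≡ C lam (i + 1))
lemma3p6 k 4≤k lam lam∈Ū z z∈Y hook≡ =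
  Ū-rows-columns (n ∸ 2) 4≤n∸2 (subst (λ m → InUbar (T m) lam) (sym (m∸n+n≡m 2≤n)) lam∈Ū) z z∈Y hook≡
  where
  n = 2 * k ∸ 1
  7≤n : 7 ≤ n
  7≤n = ∸-monoˡ-≤ 1 (*-monoʳ-≤ 2 4≤k)
  2≤n : 2 ≤ n
  2≤n = ≤-trans (s≤s (s≤s z≤n)) 7≤n
  4≤n∸2 : 4 ≤ n ∸ 2
  4≤n∸2 = ≤-trans (n≤1+n 4) (∸-monoˡ-≤ 2 7≤n)
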